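{- There exists a finite-state deep sequence $S\in\{0,1\}^\infty$.
   Context: A finite-state transducer (FST) is a 4-tuple $T=(Q,\delta,\nu,q_0)$ with $Q$ a nonempty finite set of states, $\delta:Q\times\{0,1\}\to Q$, $\nu:Q\times\{0,1\}\to\{0,1\}^*$, $q_0\in Q$, every state reachable from $q_0$. With $\widehat\delta(\lambda)=q_0$, $\widehat\delta(xa)=\delta(\widehat\delta(x),a)$, the output is $T(\lambda)=\lambda$, $T(xa)=T(x)\nu(\widehat\delta(x),a)$. Fix a standard binary encoding $\sigma_T$ of each FST and let $|T|=|\sigma_T|$; $\mathrm{FST}^{\le k}=\{T:|T|\le k\}$. For $x\in\{0,1\}^*$, $D^k_{FS}(x)=\min\{|p|:\exists T\in\mathrm{FST}^{\le k},\ T(p)=x\}$. $S\upharpoonright n$ denotes the first $n$ bits of $S$. A sequence $S$ is finite-state deep if $(\exists\alpha>0)(\forall k\in\mathbb N)(\exists k'\in\mathbb N)$ (for infinitely many $n$) $D^k_{FS}(S\upharpoonright n)-D^{k'}_{FS}(S\upharpoonright n)\ge\alpha n$. -}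

module Defs where

open import Data.Bool using (Bool; true; false)
open import Data.Nat using (ℕ; suc; _+_; _*_; _≤_)
open import Data.Fin using (Fin; toℕ)
open import Data.List using (List; []; _∷_; _++_; [_]; length; replicate; concatMap; allFin; applyUpTo)
open import Data.Product using (Σ; ∃; ∃-syntax; _×_)
open import Relation.Binary.PropositionalEquality using (_≡_)

Str : Set
Str = List Bool

ext : ∀ {n} → (Fin (suc n) → Bool → Fin (suc n)) → Fin (suc n) → Str → Fin (suc n)
ext δ q []      = q
ext δ q (a ∷ w) = ext δ (δ q a) w

-- A finite-state transducer with state set Fin (suc states) (nonempty),
-- transition δ, output ν, start state q₀, all states reachable from q₀
-- (δ̂(x) = ext δ q₀ x).
record FST : Set where
  field
    states    : ℕ
    δ         : Fin (suc states) → Bool → Fin (suc states)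
    ν         : Fin (suc states) → Bool → Str
    q₀        : Fin (suc states)
    reachable : (q : Fin (suc states)) → ∃[ x ] (ext δ q₀ x ≡ q)

-- Output of T started in state q on input w:
-- runFrom q (a w) = ν(q,a) · runFrom (δ(q,a)) w.
-- Hence T(λ)=λ and T(xa)=T(x) ν(δ̂(x),a).
runFrom : (T : FST) → Fin (suc (FST.states T)) → Str → Str
runFrom T q []      = []
runFrom T q (a ∷ w) = FST.ν T q a ++ runFrom T (FST.δ T q a) w

run : FST → Str → Str
run T = runFrom T (FST.q₀ T)

-- Standard (self-delimiting, injective) binary encoding σ_T:
--   unary(|Q|) unary(q₀) then, for each state q (in order) and a ∈ {0,1},
--   unary(δ(q,a)) dbl(ν(q,a)),
-- where unary m = 1^m 0 and dbl w doubles every bit of w and appends 01.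
unary : ℕ → Str
unary m = replicate m true ++ [ false ]

dbl : Str → Str
dbl w = concatMap (λ b → b ∷ b ∷ []) w ++ (false ∷ true ∷ [])

encode : FST → Str
encode T = unary (suc states) ++ unary (toℕ q₀)
           ++ concatMap (λ q → concatMap (λ a → unary (toℕ (δ q a)) ++ dbl (ν q a))
                                         (false ∷ true ∷ []))
                        (allFin (suc states))
  where open FST T

size : FST → ℕ
size T = length (encode T)

prefix : (ℕ → Bool) → ℕ → Str
prefix S n = applyUpTo S n

-- D^k_FS(x) ≥ m : every p with T(p) = x for some T ∈ FST^{≤k} has |p| ≥ m
-- (min of the empty set is ∞).
DFS≥ : ℕ → Str → ℕ → Set
DFS≥ k x m = (T : FST) (p : Str) → size T ≤ k → run T p ≡ x → m ≤ length p

-- D^k_FS(x) ≤ m : some T ∈ FST^{≤k} and p with T(p) = x and |p| ≤ m.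
DFS≤ : ℕ → Str → ℕ → Set
DFS≤ k x m = Σ FST λ T → Σ Str λ p → size T ≤ k × run T p ≡ x × length p ≤ m

-- D^k_FS(x) − D^{k'}_FS(x) ≥ (a/b)·n, i.e. D^{k'}_FS(x) is finite (= some m)
-- and b·D^k_FS(x) ≥ b·m + a·n.
DepthGap : ℕ → ℕ → ℕ → ℕ → Str → ℕ → Set
DepthGap k k' a b x n = ∃[ m ] (DFS≤ k' x m × ((T : FST) (p : Str) → size T ≤ k → run T p ≡ x → b * m + a * n ≤ b * length p))

-- Finite-state depth, with α = a/b for positive naturals a, b.
FSDeep : (ℕ → Bool) → Set
FSDeep S = ∃[ a ] ∃[ b ] (1 ≤ a × 1 ≤ b ×
  ((k : ℕ) → ∃[ k' ] ((m : ℕ) → ∃[ n ] (m ≤ n × DepthGap k k' a b (prefix S n) n))))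

-- For every k, counting yields a word w_k of length 3H_k that no transducer of size ≤ k outputs, even
-- as a factor, from at most H_k input bits: up to their transition tables there are boundedly many such
-- transducers, and fewer than 2^(H_k + 1) short inputs. A transducer of size ≤ k therefore needs more
-- than H_k input bits per copy of w_k w_k it outputs. The sequence is built in stages, stage t + 1
-- appending |stage t| + 1 copies of w_k w_k for k = schedule t, and schedule takes every value infinitely
-- often. At the end of such a stage a 3-state transducer that depends only on k outputs the prefix from an
-- escaped copy of stage t followed by one bit per copy, i.e. from about 3|stage t| bits. Since the prefix
-- has length about 6 H_k (|stage t| + 1), that is a gap of at least 1/8 of the prefix length.

module Submission where

open import Defs
open import Function using (_∘_)
open import Data.Bool using (Bool; true; false; if_then_else_)
open import Data.Nat using (ℕ; zero; suc; _+_; _*_; _∸_; _^_; _≤_; _<_; _≤′_; ≤′-refl; ≤′-step; z≤n; s≤s; _≤?_; _<?_)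
open import Data.Nat.Properties
open import Data.Nat.Tactic.RingSolver using (solve-∀)
open import Data.Fin using (Fin; toℕ) renaming (zero to fzero; suc to fsuc)
open import Data.List using (List; []; _∷_; _++_; [_]; length; map; concatMap; upTo; take; drop; replicate; allFin; applyUpTo; cartesianProduct; cartesianProductWith)
open import Data.List.Properties using (length-++; ++-assoc; ++-identityʳ; ∷-injective; length-map; length-upTo; length-++-≤ˡ; length-++-≤ʳ; length-replicate)
open import Data.List.Membership.Propositional using (_∈_; _∉_)
open import Data.List.Membership.Propositional.Properties using (∈-map⁺; ∈-++⁺ˡ; ∈-++⁺ʳ; ∈-allFin; ∈-upTo⁺; ∈-concat⁺′; ∈-cartesianProduct⁺; ∈-cartesianProductWith⁺)
open import Data.List.Relation.Unary.Any using (here; there)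
import Data.Vec.Functional as Vector
open import Data.Product using (Σ-syntax; ∃₂; ∃-syntax; _×_; _,_; proj₁; proj₂)
open import Data.Sum using (inj₁; inj₂)
open import Data.Empty using (⊥-elim)
open import Relation.Nullary using (yes; no)
open import Relation.Binary.PropositionalEquality using (_≡_; _≗_; refl; sym; trans; cong; cong₂; subst; module ≡-Reasoning)

++-split : ∀ {A : Set} (a b c d : List A) → a ++ b ≡ c ++ d → length c ≤ length a →
           ∃[ m ] (a ≡ c ++ m × d ≡ m ++ b)
++-split a       b []      d eq _ = a , refl , sym eq
++-split (x ∷ a) b (y ∷ c) d eq (s≤s c≤a) with refl , eq′ ← ∷-injective eq
  with m , a≡cm , d≡mb ← ++-split a b c d eq′ c≤a = m , cong (x ∷_) a≡cm , d≡mb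

∈⇒length-≤-concatMap : ∀ {A B : Set} (f : A → List B) {x : A} {xs : List A} →
                       x ∈ xs → length (f x) ≤ length (concatMap f xs)
∈⇒length-≤-concatMap f {xs = x ∷ xs} (here refl) = length-++-≤ˡ (f x)
∈⇒length-≤-concatMap f {xs = x ∷ xs} (there x∈xs) =
  ≤-trans (∈⇒length-≤-concatMap f x∈xs) (length-++-≤ʳ (concatMap f xs) {f x})

length-concatMap-≤ : ∀ {A B : Set} (f : A → List B) (xs : List A) {c : ℕ} →
                     (∀ x → length (f x) ≤ c) → length (concatMap f xs) ≤ length xs * c
length-concatMap-≤ f []       fc = z≤n
length-concatMap-≤ f (x ∷ xs) fc = begin
  length (f x ++ concatMap f xs)          ≡⟨ length-++ (f x) ⟩
  length (f x) + length (concatMap f xs)  ≤⟨ +-mono-≤ (fc x) (length-concatMap-≤ f xs fc) ⟩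
  _                                       ∎
  where open ≤-Reasoning

∈-concatMap⁺′ : ∀ {A B : Set} (f : A → List B) {y : B} {x : A} {xs : List A} →
                y ∈ f x → x ∈ xs → y ∈ concatMap f xs
∈-concatMap⁺′ f y∈fx x∈xs = ∈-concat⁺′ y∈fx (∈-map⁺ f x∈xs)

module _ (T : FST) where
  open FST T

  runFrom-++ : ∀ q u v → runFrom T q (u ++ v) ≡ runFrom T q u ++ runFrom T (ext δ q u) v
  runFrom-++ q []      v = refl
  runFrom-++ q (a ∷ u) v = begin
    ν q a ++ runFrom T (δ q a) (u ++ v)                             ≡⟨ cong (ν q a ++_) (runFrom-++ (δ q a) u v) ⟩
    ν q a ++ (runFrom T (δ q a) u ++ runFrom T (ext δ (δ q a) u) v) ≡⟨ ++-assoc (ν q a) _ _ ⟨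
    (ν q a ++ runFrom T (δ q a) u) ++ runFrom T (ext δ (δ q a) u) v ∎
    where open ≡-Reasoning

  module _ {K : ℕ} (ν≤K : ∀ q a → length (ν q a) ≤ K) where

    length-runFrom-≤ : ∀ q u → length (runFrom T q u) ≤ length u * K
    length-runFrom-≤ q []      = z≤n
    length-runFrom-≤ q (a ∷ u) = begin
      length (ν q a ++ runFrom T (δ q a) u)          ≡⟨ length-++ (ν q a) ⟩
      length (ν q a) + length (runFrom T (δ q a) u)  ≤⟨ +-mono-≤ (ν≤K q a) (length-runFrom-≤ (δ q a) u) ⟩
      K + length u * K                               ∎
      where open ≤-Reasoning

    runFrom-cover : ∀ q p N → N ≤ length (runFrom T q p) →
      ∃₂ λ u v → p ≡ u ++ v × N ≤ length (runFrom T q u) × length (runFrom T q u) ≤ N + K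
    runFrom-cover q []      N N≤ = [] , [] , refl , N≤ , z≤n
    runFrom-cover q (a ∷ p) N N≤ with N ≤? length (ν q a)
    ... | yes N≤r =
      [ a ] , p , refl , subst (N ≤_) length-ν≡ N≤r , subst (_≤ N + K) length-ν≡ (≤-trans (ν≤K q a) (m≤n+m K N))
      where
        length-ν≡ : length (ν q a) ≡ length (runFrom T q [ a ])
        length-ν≡ = cong length (sym (++-identityʳ (ν q a)))
    ... | no N≰r = extend (runFrom-cover (δ q a) p (N ∸ r) N∸r≤L)
      where
        r = length (ν q a)
        r≤N : r ≤ N
        r≤N = ≤-trans (n≤1+n r) (≰⇒> N≰r)
        N∸r≤L : N ∸ r ≤ length (runFrom T (δ q a) p)
        N∸r≤L = begin
          N ∸ r                                 ≤⟨ ∸-monoˡ-≤ r (subst (N ≤_) (length-++ (ν q a)) N≤) ⟩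
          r + length (runFrom T (δ q a) p) ∸ r  ≡⟨ m+n∸m≡n r _ ⟩
          length (runFrom T (δ q a) p)          ∎
          where open ≤-Reasoning
        extend : (∃₂ λ u v → p ≡ u ++ v × N ∸ r ≤ length (runFrom T (δ q a) u)
                                         × length (runFrom T (δ q a) u) ≤ N ∸ r + K) →
                 ∃₂ λ u v → a ∷ p ≡ u ++ v × N ≤ length (runFrom T q u) × length (runFrom T q u) ≤ N + K
        extend (u , v , refl , lo , hi) = a ∷ u , v , refl , lo′ , hi′
          where
            open ≤-Reasoning
            lo′ : N ≤ length (ν q a ++ runFrom T (δ q a) u)
            lo′ = begin
              N                                      ≡⟨ m+[n∸m]≡n r≤N ⟨
              r + (N ∸ r)                            ≤⟨ +-monoʳ-≤ r lo ⟩
              r + length (runFrom T (δ q a) u)       ≡⟨ length-++ (ν q a) ⟨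
              length (ν q a ++ runFrom T (δ q a) u)  ∎
            hi′ : length (ν q a ++ runFrom T (δ q a) u) ≤ N + K
            hi′ = begin
              length (ν q a ++ runFrom T (δ q a) u)  ≡⟨ length-++ (ν q a) ⟩
              r + length (runFrom T (δ q a) u)       ≤⟨ +-monoʳ-≤ r hi ⟩
              r + (N ∸ r + K)                        ≡⟨ +-assoc r (N ∸ r) K ⟨
              r + (N ∸ r) + K                        ≡⟨ cong (_+ K) (m+[n∸m]≡n r≤N) ⟩
              N + K                                  ∎

repeat : ℕ → Str → Str
repeat zero    v = []
repeat (suc j) v = v ++ repeat j v

length-repeat : ∀ j v → length (repeat j v) ≡ j * length v
length-repeat zero    v = refl
length-repeat (suc j) v = trans (length-++ v) (cong (length v +_) (length-repeat j v))

HardFactor : FST → ℕ → Str → Set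
HardFactor T H w = ∀ q u y z → runFrom T q u ≡ y ++ w ++ z → H < length u

-- Cut the input where the output first covers y ++ w: as no transition outputs more than |w| bits,
-- the rest of the output starts inside the second w, so the induction continues with fewer copies.
repeat-input-≥ : ∀ T {H w} → (∀ q a → length (FST.ν T q a) ≤ length w) → HardFactor T H w →
                 ∀ j q p y → runFrom T q p ≡ y ++ repeat j (w ++ w) → j * suc H ≤ length p
repeat-input-≥ T ν≤w hard zero    q p y _    = z≤n
repeat-input-≥ T {H} {w} ν≤w hard (suc j) q p y out≡ =
  bound (runFrom-cover T ν≤w q p (length (y ++ w)) yw≤out)
  where
    open FST T
    X = repeat j (w ++ w)
    out≡′ : runFrom T q p ≡ (y ++ w) ++ (w ++ X)
    out≡′ = begin
      runFrom T q p           ≡⟨ out≡ ⟩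
      y ++ ((w ++ w) ++ X)    ≡⟨ cong (y ++_) (++-assoc w w X) ⟩
      y ++ (w ++ (w ++ X))    ≡⟨ ++-assoc y w (w ++ X) ⟨
      (y ++ w) ++ (w ++ X)    ∎
      where open ≡-Reasoning
    yw≤out : length (y ++ w) ≤ length (runFrom T q p)
    yw≤out = subst (λ o → length (y ++ w) ≤ length o) (sym out≡′) (length-++-≤ˡ (y ++ w))
    bound : (∃₂ λ u v → p ≡ u ++ v × length (y ++ w) ≤ length (runFrom T q u)
                                   × length (runFrom T q u) ≤ length (y ++ w) + length w) →
            suc j * suc H ≤ length p
    bound (u , v , refl , lo , hi)
      with m , u-out , wX≡ ← ++-split (runFrom T q u) _ (y ++ w) (w ++ X)
                               (trans (sym (runFrom-++ T q u v)) out≡′) lo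
      with m′ , _ , v-out ← ++-split w X m _ wX≡
             (+-cancelˡ-≤ (length (y ++ w)) _ _
               (subst (_≤ length (y ++ w) + length w) (trans (cong length u-out) (length-++ (y ++ w))) hi))
      = subst (suc j * suc H ≤_) (sym (length-++ u))
          (+-mono-≤ (hard q u y m (trans u-out (++-assoc y w m)))
                    (repeat-input-≥ T ν≤w hard j (ext δ q u) v m′ v-out))

strip : Bool → List Str → List Str
strip b       []              = []
strip b       ([] ∷ L)        = strip b L
strip false   ((false ∷ x) ∷ L) = x ∷ strip false L
strip false   ((true ∷ x) ∷ L)  = strip false L
strip true    ((true ∷ x) ∷ L)  = x ∷ strip true L
strip true    ((false ∷ x) ∷ L) = strip true L

length-strip : ∀ L → length (strip false L) + length (strip true L) ≤ length L
length-strip []                = z≤n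
length-strip ([] ∷ L)          = m≤n⇒m≤1+n (length-strip L)
length-strip ((false ∷ x) ∷ L) = s≤s (length-strip L)
length-strip ((true ∷ x) ∷ L)  = ≤-trans (≤-reflexive (+-suc _ _)) (s≤s (length-strip L))

∈-strip : ∀ b x L → (b ∷ x) ∈ L → x ∈ strip b L
∈-strip false x ((false ∷ .x) ∷ L) (here refl)  = here refl
∈-strip true  x ((true ∷ .x) ∷ L)  (here refl)  = here refl
∈-strip b     x ([] ∷ L)           (there b∷x∈) = ∈-strip b x L b∷x∈
∈-strip false x ((false ∷ y) ∷ L)  (there b∷x∈) = there (∈-strip false x L b∷x∈)
∈-strip false x ((true ∷ y) ∷ L)   (there b∷x∈) = ∈-strip false x L b∷x∈
∈-strip true  x ((true ∷ y) ∷ L)   (there b∷x∈) = there (∈-strip true x L b∷x∈)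
∈-strip true  x ((false ∷ y) ∷ L)  (there b∷x∈) = ∈-strip true x L b∷x∈

strip-< : ∀ ℓ L → length L < 2 ^ suc ℓ → ∃[ b ] length (strip b L) < 2 ^ ℓ
strip-< ℓ L |L|< with length (strip false L) <? 2 ^ ℓ
... | yes |L₀|< = false , |L₀|<
... | no  |L₀|≮ = true , +-cancelˡ-< (2 ^ ℓ) _ _ (begin-strict
  2 ^ ℓ + length (strip true L)                  ≤⟨ +-monoˡ-≤ _ (≮⇒≥ |L₀|≮) ⟩
  length (strip false L) + length (strip true L) ≤⟨ length-strip L ⟩
  length L                                       <⟨ |L|< ⟩
  2 ^ ℓ + (2 ^ ℓ + 0)                            ≡⟨ cong (2 ^ ℓ +_) (+-identityʳ (2 ^ ℓ)) ⟩
  2 ^ ℓ + 2 ^ ℓ                                  ∎)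
  where open ≤-Reasoning

missing-string : ∀ ℓ (L : List Str) → length L < 2 ^ ℓ → ∃[ w ] (length w ≡ ℓ × w ∉ L)
missing-string zero    []      _        = [] , refl , λ ()
missing-string zero    (_ ∷ _) (s≤s ())
missing-string (suc ℓ) L |L|<
  with b , |Lᵇ|< ← strip-< ℓ L |L|<
  with w , refl , w∉ ← missing-string ℓ (strip b L) |Lᵇ|<
  = b ∷ w , refl , w∉ ∘ ∈-strip b w L

length-≤-dbl : ∀ w → length w ≤ length (dbl w)
length-≤-dbl w = ≤-trans (doubled w) (length-++-≤ˡ (concatMap (λ b → b ∷ b ∷ []) w))
  where
    doubled : ∀ w → length w ≤ length (concatMap (λ b → b ∷ b ∷ []) w)
    doubled []      = z≤n
    doubled (b ∷ w) = s≤s (m≤n⇒m≤1+n (doubled w))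

module _ (T : FST) where
  open FST T

  ν≤size : ∀ q a → length (ν q a) ≤ size T
  ν≤size q a = begin
    length (ν q a)                                       ≤⟨ length-≤-dbl (ν q a) ⟩
    length (dbl (ν q a))                                 ≤⟨ length-++-≤ʳ (dbl (ν q a)) {unary (toℕ (δ q a))} ⟩
    length (entry q a)                                   ≤⟨ ∈⇒length-≤-concatMap (entry q) (∈-bits a) ⟩
    length (entries q)                                   ≤⟨ ∈⇒length-≤-concatMap entries (∈-allFin q) ⟩
    length (concatMap entries (allFin (suc states)))     ≤⟨ length-++-≤ʳ _ {unary (toℕ q₀)} ⟩
    length (unary (toℕ q₀) ++ concatMap entries (allFin (suc states))) ≤⟨ length-++-≤ʳ _ {unary (suc states)} ⟩
    size T                                               ∎
    where
      open ≤-Reasoning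
      entry : Fin (suc states) → Bool → Str
      entry q a = unary (toℕ (δ q a)) ++ dbl (ν q a)
      entries : Fin (suc states) → Str
      entries q = concatMap (entry q) (false ∷ true ∷ [])
      ∈-bits : ∀ a → a ∈ false ∷ true ∷ []
      ∈-bits false = here refl
      ∈-bits true  = there (here refl)

  states<size : states < size T
  states<size = begin
    suc states                                  ≡⟨ length-replicate (suc states) ⟨
    length (replicate (suc states) true)        ≤⟨ length-++-≤ˡ (replicate (suc states) true) ⟩
    length (unary (suc states))                 ≤⟨ length-++-≤ˡ (unary (suc states)) ⟩
    size T                                      ∎
    where open ≤-Reasoning

Transition : ℕ → Set
Transition s = Fin (suc s) × Str

Table : ℕ → Set
Table s = Fin (suc s) → Transition s × Transition s

select : ∀ {s} → Transition s × Transition s → Bool → Transition s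
select (t₀ , t₁) a = if a then t₁ else t₀

exec : ∀ {s} → Table s → Fin (suc s) → Str → Str
exec τ q []      = []
exec τ q (a ∷ u) = proj₂ (select (τ q) a) ++ exec τ (proj₁ (select (τ q) a)) u

table : (T : FST) → Table (FST.states T)
table T q = (δ q false , ν q false) , (δ q true , ν q true)
  where open FST T

exec-table : ∀ T {τ} → τ ≗ table T → ∀ q u → exec τ q u ≡ runFrom T q u
exec-table T τ≗ q []          = refl
exec-table T τ≗ q (false ∷ u) rewrite τ≗ q = cong (FST.ν T q false ++_) (exec-table T τ≗ _ u)
exec-table T τ≗ q (true ∷ u)  rewrite τ≗ q = cong (FST.ν T q true ++_) (exec-table T τ≗ _ u)

functions : ∀ {A : Set} n → List A → List (Vector.Vector A n)
functions zero    xs = [ Vector.[] ]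
functions (suc n) xs = cartesianProductWith Vector._∷_ xs (functions n xs)

functions-complete : ∀ {A : Set} n {xs : List A} (f : Vector.Vector A n) → (∀ i → f i ∈ xs) →
                     ∃[ g ] (g ∈ functions n xs × g ≗ f)
functions-complete zero    f _  = Vector.[] , here refl , λ ()
functions-complete (suc n) f f∈
  with g , g∈ , g≗ ← functions-complete n (Vector.tail f) (f∈ ∘ fsuc)
  = Vector.head f Vector.∷ g , ∈-cartesianProductWith⁺ Vector._∷_ (f∈ fzero) g∈ , λ { fzero → refl ; (fsuc i) → g≗ i }

stringsUpTo : ℕ → List Str
stringsUpTo zero    = [ [] ]
stringsUpTo (suc n) = [] ∷ map (false ∷_) (stringsUpTo n) ++ map (true ∷_) (stringsUpTo n)

stringsUpTo-complete : ∀ n x → length x ≤ n → x ∈ stringsUpTo n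
stringsUpTo-complete zero    []          _         = here refl
stringsUpTo-complete (suc n) []          _         = here refl
stringsUpTo-complete (suc n) (false ∷ x) (s≤s x≤n) =
  there (∈-++⁺ˡ (∈-map⁺ (false ∷_) (stringsUpTo-complete n x x≤n)))
stringsUpTo-complete (suc n) (true ∷ x)  (s≤s x≤n) =
  there (∈-++⁺ʳ (map (false ∷_) (stringsUpTo n)) (∈-map⁺ (true ∷_) (stringsUpTo-complete n x x≤n)))

length-stringsUpTo : ∀ n → length (stringsUpTo n) < 2 ^ suc n
length-stringsUpTo zero    = s≤s (s≤s z≤n)
length-stringsUpTo (suc n) = begin-strict
  length (stringsUpTo (suc n))  ≡⟨ cong suc (trans (length-++ (map (false ∷_) (stringsUpTo n)))
                                     (cong₂ _+_ (length-map _ (stringsUpTo n)) (length-map _ (stringsUpTo n)))) ⟩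
  suc (L + L)                   <⟨ s≤s (+-monoʳ-< L (n<1+n L)) ⟩
  suc L + suc L                 ≤⟨ +-mono-≤ (length-stringsUpTo n) (length-stringsUpTo n) ⟩
  2 ^ suc n + 2 ^ suc n         ≡⟨ cong (2 ^ suc n +_) (+-identityʳ (2 ^ suc n)) ⟨
  2 ^ suc (suc n)               ∎
  where
    open ≤-Reasoning
    L = length (stringsUpTo n)

transitions : ℕ → (s : ℕ) → List (Transition s)
transitions k s = cartesianProduct (allFin (suc s)) (stringsUpTo k)

∈-transitions : ∀ {k} T → size T ≤ k → ∀ q a → (FST.δ T q a , FST.ν T q a) ∈ transitions k (FST.states T)
∈-transitions {k} T T≤k q a =
  ∈-cartesianProduct⁺ (∈-allFin _) (stringsUpTo-complete k _ (≤-trans (ν≤size T q a) T≤k))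

Config : Set
Config = Σ[ s ∈ ℕ ] (Table s × Fin (suc s))

configsWith : ℕ → ℕ → List Config
configsWith k s = cartesianProductWith (λ τ q → s , τ , q)
                    (functions (suc s) (cartesianProduct (transitions k s) (transitions k s))) (allFin (suc s))

configs : ℕ → List Config
configs k = concatMap (configsWith k) (upTo k)

configs-complete : ∀ {k} T → size T ≤ k → ∀ q → ∃[ τ ] ((FST.states T , τ , q) ∈ configs k × τ ≗ table T)
configs-complete {k} T T≤k q =
  let τ , τ∈ , τ≗ = functions-complete (suc s) (table T)
                      (λ q′ → ∈-cartesianProduct⁺ (∈-transitions T T≤k q′ false) (∈-transitions T T≤k q′ true))
  in τ , ∈-concatMap⁺′ (configsWith k) {x = s} (∈-cartesianProductWith⁺ (λ τ q → s , τ , q) τ∈ (∈-allFin q))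
                       (∈-upTo⁺ (≤-trans (states<size T) T≤k)) , τ≗
  where s = FST.states T

windows : ℕ → ℕ → Str → List Str
windows ℓ W o = map (λ i → take ℓ (drop i o)) (upTo W)

∈-windows : ∀ {W} y w z → length y < W → w ∈ windows (length w) W (y ++ w ++ z)
∈-windows {W} y w z y<W =
  subst (_∈ windows (length w) W (y ++ w ++ z)) (trans (cong (take (length w)) (drop-y y)) (take-w w))
        (∈-map⁺ (λ i → take (length w) (drop i (y ++ w ++ z))) (∈-upTo⁺ y<W))
  where
    drop-y : ∀ y → drop (length y) (y ++ w ++ z) ≡ w ++ z
    drop-y []      = refl
    drop-y (_ ∷ y) = drop-y y
    take-w : ∀ w → take (length w) (w ++ z) ≡ w
    take-w []      = refl
    take-w (b ∷ w) = cong (b ∷_) (take-w w)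

-- A transducer of size ≤ k outputs at most k bits per input bit, so factors of its output on at most
-- H input bits start before position k * H.
factors : ℕ → ℕ → ℕ → Config → List Str
factors k H ℓ (s , τ , q) = concatMap (λ u → windows ℓ (k * H) (exec τ q u)) (stringsUpTo H)

outputFactors : ℕ → ℕ → ℕ → List Str
outputFactors k H ℓ = concatMap (factors k H ℓ) (configs k)

∈-outputFactors : ∀ {k H} T → size T ≤ k → ∀ q u y w z → runFrom T q u ≡ y ++ w ++ z → length u ≤ H →
                  0 < length w → w ∈ outputFactors k H (length w)
∈-outputFactors {k} {H} T T≤k q u y w z out≡ u≤H 0<w = via-config (configs-complete T T≤k q)
  where
    y<kH : length y < k * H
    y<kH = begin-strict
      length y                   <⟨ m<m+n (length y) 0<w ⟩
      length y + length w        ≤⟨ +-monoʳ-≤ (length y) (length-++-≤ˡ w) ⟩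
      length y + length (w ++ z) ≡⟨ length-++ y ⟨
      length (y ++ w ++ z)       ≡⟨ cong length out≡ ⟨
      length (runFrom T q u)     ≤⟨ length-runFrom-≤ T (λ q a → ≤-trans (ν≤size T q a) T≤k) q u ⟩
      length u * k               ≤⟨ *-monoˡ-≤ k u≤H ⟩
      H * k                      ≡⟨ *-comm H k ⟩
      k * H                      ∎
      where open ≤-Reasoning
    via-config : ∃[ τ ] ((FST.states T , τ , q) ∈ configs k × τ ≗ table T) → w ∈ outputFactors k H (length w)
    via-config (τ , τ∈ , τ≗) =
      ∈-concatMap⁺′ (factors k H (length w)) {x = FST.states T , τ , q}
        (∈-concatMap⁺′ (λ u → windows (length w) (k * H) (exec τ q u)) {x = u} w∈ (stringsUpTo-complete H u u≤H)) τ∈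
      where
        w∈ : w ∈ windows (length w) (k * H) (exec τ q u)
        w∈ = subst (λ o → w ∈ windows (length w) (k * H) o) (sym (trans (exec-table T τ≗ q u) out≡))
                   (∈-windows y w z y<kH)

length-outputFactors : ∀ k H ℓ → length (outputFactors k H ℓ) ≤ length (configs k) * (length (stringsUpTo H) * (k * H))
length-outputFactors k H ℓ =
  length-concatMap-≤ _ (configs k) λ { (s , τ , q) →
    length-concatMap-≤ _ (stringsUpTo H) λ u → ≤-reflexive (trans (length-map _ (upTo (k * H))) (length-upTo (k * H))) }

n<2^n : ∀ n → n < 2 ^ n
n<2^n zero    = s≤s z≤n
n<2^n (suc n) = begin-strict
  suc n              ≤⟨ n<2^n n ⟩
  2 ^ n              <⟨ m<m+n (2 ^ n) (m^n>0 2 n) ⟩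
  2 ^ n + 2 ^ n      ≡⟨ cong (2 ^ n +_) (+-identityʳ (2 ^ n)) ⟨
  2 ^ suc n          ∎
  where open ≤-Reasoning

-- Fewer than 2 ^ (H + 1) inputs, and k · |configs k| · H < 2 ^ N · 2 ^ H.
length-outputFactors-< : ∀ k N ℓ → k * length (configs k) ≤ N → length (outputFactors k (suc N) ℓ) < 2 ^ (3 * suc N)
length-outputFactors-< k N ℓ kc≤N = begin-strict
  length (outputFactors k H ℓ)  ≤⟨ length-outputFactors k H ℓ ⟩
  c * (length (stringsUpTo H) * (k * H)) ≤⟨ *-monoʳ-≤ c (*-monoˡ-≤ (k * H) (<⇒≤ (length-stringsUpTo H))) ⟩
  c * (X * (k * H))             ≡⟨ rearrange c X k H ⟩
  X * (k * c * H)               <⟨ *-monoʳ-< X {{m^n≢0 2 (suc H)}} (*-mono-< (≤-<-trans kc≤N (n<2^n N)) (n<2^n H)) ⟩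
  X * (2 ^ N * 2 ^ H)           ≡⟨ cong (X *_) (^-distribˡ-+-* 2 N H) ⟨
  X * 2 ^ (N + H)               ≡⟨ ^-distribˡ-+-* 2 (suc H) (N + H) ⟨
  2 ^ (suc H + (N + H))         ≡⟨ cong (2 ^_) (exponent N) ⟩
  2 ^ (3 * H)                   ∎
  where
    open ≤-Reasoning
    H = suc N
    c = length (configs k)
    X = 2 ^ suc H
    rearrange : ∀ c X k H → c * (X * (k * H)) ≡ X * (k * c * H)
    rearrange = solve-∀
    exponent : ∀ N → suc (suc N) + (N + suc N) ≡ 3 * suc N
    exponent = solve-∀

∉⇒HardFactor : ∀ k H w → 0 < length w → w ∉ outputFactors k H (length w) → ∀ T → size T ≤ k → HardFactor T H w
∉⇒HardFactor k H w 0<w w∉ T T≤k q u y z out≡ with H <? length u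
... | yes H<u = H<u
... | no  H≮u = ⊥-elim (w∉ (∈-outputFactors {k} {H} T T≤k q u y w z out≡ (≮⇒≥ H≮u) 0<w))

hardWord-exists : ∀ k N → k * length (configs k) ≤ N →
           ∃[ w ] (length w ≡ 3 * suc N × ∀ T → size T ≤ k → HardFactor T (suc N) w)
hardWord-exists k N kc≤N = harden (missing-string ℓ (outputFactors k (suc N) ℓ) (length-outputFactors-< k N ℓ kc≤N))
  where
    ℓ = 3 * suc N
    harden : ∃[ w ] (length w ≡ ℓ × w ∉ outputFactors k (suc N) ℓ) →
             ∃[ w ] (length w ≡ ℓ × ∀ T → size T ≤ k → HardFactor T (suc N) w)
    harden (w , |w|≡ , w∉) = w , |w|≡ , ∉⇒HardFactor k (suc N) w (subst (0 <_) (sym |w|≡) (s≤s z≤n))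
                                           (subst (λ ℓ → w ∉ outputFactors k (suc N) ℓ) (sym |w|≡) w∉)

pattern copying = fzero
pattern escaped = fsuc fzero
pattern looping = fsuc (fsuc fzero)

-- Copies its input up to the first 01, where each 0 of the copied part is written 00, and then
-- writes v once for every further input bit.
repeater : Str → FST
repeater v = record { states = 2 ; δ = δ ; ν = ν ; q₀ = copying ; reachable = reachable }
  where
    δ : Fin 3 → Bool → Fin 3
    δ copying true  = copying
    δ copying false = escaped
    δ escaped false = copying
    δ escaped true  = looping
    δ looping _     = looping
    ν : Fin 3 → Bool → Str
    ν copying true  = [ true ]
    ν copying false = []
    ν escaped false = [ false ]
    ν escaped true  = []
    ν looping _     = v
    reachable : ∀ q → ∃[ x ] ext δ copying x ≡ q
    reachable copying = [] , refl
    reachable escaped = [ false ] , refl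
    reachable looping = false ∷ true ∷ [] , refl

escape : Str → Str
escape []          = []
escape (true ∷ x)  = true ∷ escape x
escape (false ∷ x) = false ∷ false ∷ escape x

repeaterInput : Str → ℕ → Str
repeaterInput E j = escape E ++ false ∷ true ∷ replicate j true

run-repeater : ∀ v E j → run (repeater v) (repeaterInput E j) ≡ E ++ repeat j v
run-repeater v E j = trans (copy E) (cong (E ++_) (loop j))
  where
    copy : ∀ E {r} → runFrom (repeater v) copying (escape E ++ r) ≡ E ++ runFrom (repeater v) copying r
    copy []          = refl
    copy (true ∷ E)  = cong (true ∷_) (copy E)
    copy (false ∷ E) = cong (false ∷_) (copy E)
    loop : ∀ j → runFrom (repeater v) looping (replicate j true) ≡ repeat j v
    loop zero    = refl
    loop (suc j) = cong (v ++_) (loop j)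

length-repeaterInput : ∀ E j → length (repeaterInput E j) ≤ length E + length E + (2 + j)
length-repeaterInput E j = begin
  length (repeaterInput E j)                        ≡⟨ length-++ (escape E) ⟩
  length (escape E) + (2 + length (replicate j true)) ≡⟨ cong (λ n → length (escape E) + (2 + n)) (length-replicate j) ⟩
  length (escape E) + (2 + j)                       ≤⟨ +-monoˡ-≤ (2 + j) (length-escape E) ⟩
  length E + length E + (2 + j)                     ∎
  where
    open ≤-Reasoning
    length-escape : ∀ E → length (escape E) ≤ length E + length E
    length-escape []          = z≤n
    length-escape (true ∷ E)  = s≤s (≤-trans (length-escape E) (+-monoʳ-≤ (length E) (n≤1+n _)))
    length-escape (false ∷ E) = s≤s (≤-trans (s≤s (length-escape E)) (≤-reflexive (sym (+-suc _ _))))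

-- With H = 9 + h, the right side exceeds the left by e + 2 + 2 h (e + 1).
block-arithmetic : ∀ e H → 9 ≤ H →
  8 * (e + e + (2 + suc e)) + 1 * (e + suc e * (3 * H + 3 * H)) ≤ 8 * (suc e * suc H)
block-arithmetic e H 9≤H with h , refl ← m≤n⇒∃[o]m+o≡n 9≤H =
  m+n≤o⇒m≤o _ (≤-reflexive (identity e h))
  where
    identity : ∀ e h → 8 * (e + e + (2 + suc e)) + 1 * (e + suc e * (3 * (9 + h) + 3 * (9 + h)))
                         + (e + 2 + 2 * h * suc e) ≡ 8 * (suc e * suc (9 + h))
    identity = solve-∀

block-gap : ∀ k H w E → 9 ≤ H → length w ≡ 3 * H → k ≤ length w → (∀ T → size T ≤ k → HardFactor T H w) →
            let x = E ++ repeat (suc (length E)) (w ++ w) in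
            DepthGap k (size (repeater (w ++ w))) 1 8 x (length x)
block-gap k H w E 9≤H |w|≡ k≤w hard =
  length p , (repeater (w ++ w) , p , ≤-refl , run-repeater (w ++ w) E j , ≤-refl) , gap
  where
    e = length E
    j = suc e
    x = E ++ repeat j (w ++ w)
    p = repeaterInput E j
    length-x : length x ≡ e + j * (3 * H + 3 * H)
    length-x = begin
      length x                         ≡⟨ length-++ E ⟩
      e + length (repeat j (w ++ w))   ≡⟨ cong (e +_) (length-repeat j (w ++ w)) ⟩
      e + j * length (w ++ w)          ≡⟨ cong (λ n → e + j * n) (trans (length-++ w) (cong₂ _+_ |w|≡ |w|≡)) ⟩
      e + j * (3 * H + 3 * H)          ∎
      where open ≡-Reasoning
    gap : ∀ T p′ → size T ≤ k → run T p′ ≡ x → 8 * length p + 1 * length x ≤ 8 * length p′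
    gap T p′ T≤k out≡ = begin
      8 * length p + 1 * length x                            ≤⟨ +-monoˡ-≤ _ (*-monoʳ-≤ 8 (length-repeaterInput E j)) ⟩
      8 * (e + e + (2 + j)) + 1 * length x                   ≡⟨ cong (λ n → 8 * (e + e + (2 + j)) + 1 * n) length-x ⟩
      8 * (e + e + (2 + j)) + 1 * (e + j * (3 * H + 3 * H))  ≤⟨ block-arithmetic e H 9≤H ⟩
      8 * (j * suc H)                                        ≤⟨ *-monoʳ-≤ 8 p′-long ⟩
      8 * length p′                                          ∎
      where
        open ≤-Reasoning
        ν≤w : ∀ q a → length (FST.ν T q a) ≤ length w
        ν≤w q a = ≤-trans (ν≤size T q a) (≤-trans T≤k k≤w)
        p′-long : j * suc H ≤ length p′
        p′-long = repeat-input-≥ T ν≤w (hard T T≤k) j (FST.q₀ T) p′ E out≡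

-- countdown r c t: t steps after value c in round r of the sequence 0; 1 0; 2 1 0; …,
-- in which round r counts down from r to 0.
countdown : ℕ → ℕ → ℕ → ℕ
countdown r c       zero    = c
countdown r zero    (suc t) = countdown (suc r) (suc r) t
countdown r (suc c) (suc t) = countdown r c t

schedule : ℕ → ℕ
schedule = countdown 0 0

countdown-down : ∀ r d c → countdown r (d + c) d ≡ c
countdown-down r zero    c = refl
countdown-down r (suc d) c = countdown-down r d c

countdown-next-round : ∀ r c t → countdown r c (suc c + t) ≡ countdown (suc r) (suc r) t
countdown-next-round r zero    t = refl
countdown-next-round r (suc c) t = countdown-next-round r c t

schedule-round : ∀ r → ∃[ T ] (r ≤ T × ∀ t → schedule (T + t) ≡ countdown r r t)
schedule-round zero = 0 , z≤n , λ t → refl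
schedule-round (suc r) with T , r≤T , start ← schedule-round r =
  T + suc r , m≤n+m (suc r) T , λ t → begin
    schedule (T + suc r + t)     ≡⟨ cong schedule (+-assoc T (suc r) t) ⟩
    schedule (T + (suc r + t))   ≡⟨ start (suc r + t) ⟩
    countdown r r (suc r + t)    ≡⟨ countdown-next-round r r t ⟩
    countdown (suc r) (suc r) t  ∎
  where open ≡-Reasoning

schedule-hits : ∀ k m → ∃[ t ] (m ≤ t × schedule t ≡ k)
schedule-hits k m with T , _ , start ← schedule-round (m + k) =
  T + m , m≤n+m m T , trans (start m) (countdown-down (m + k) m k)

-- N ≥ k · |configs k| for the counting, and H = N + 1 ≥ 9 for block-arithmetic.
wordBound : ℕ → ℕ
wordBound k = k * length (configs k) + (k + 8)

-- Opaque, as unfolding word runs the exhaustive search behind hardWord-exists.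
opaque
  word : ℕ → Str
  word k = proj₁ (hardWord-exists k (wordBound k) (m≤m+n _ _))

  word-length : ∀ k → length (word k) ≡ 3 * suc (wordBound k)
  word-length k = proj₁ (proj₂ (hardWord-exists k (wordBound k) (m≤m+n _ _)))

  word-hard : ∀ k T → size T ≤ k → HardFactor T (suc (wordBound k)) (word k)
  word-hard k = proj₂ (proj₂ (hardWord-exists k (wordBound k) (m≤m+n _ _)))

k≤wordBound : ∀ k → k + 8 ≤ wordBound k
k≤wordBound k = m≤n+m (k + 8) (k * length (configs k))

stage : ℕ → Str
stage zero    = []
stage (suc t) = stage t ++ repeat (suc (length (stage t))) (word (schedule t) ++ word (schedule t))

stage-gap : ∀ t → DepthGap (schedule t) (size (repeater (word (schedule t) ++ word (schedule t)))) 1 8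
                           (stage (suc t)) (length (stage (suc t)))
stage-gap t = block-gap k (suc N) (word k) (stage t) 9≤H (word-length k) k≤w (word-hard k)
  where
    k = schedule t
    N = wordBound k
    9≤H : 9 ≤ suc N
    9≤H = s≤s (≤-trans (m≤n+m 8 k) (k≤wordBound k))
    k≤w : k ≤ length (word k)
    k≤w = begin
      k                ≤⟨ ≤-trans (m≤m+n k 8) (k≤wordBound k) ⟩
      N                ≤⟨ ≤-trans (n≤1+n N) (m≤m+n (suc N) _) ⟩
      3 * suc N        ≡⟨ word-length k ⟨
      length (word k)  ∎
      where open ≤-Reasoning

stage-extends : ∀ {t t′} → t ≤′ t′ → ∃[ y ] stage t′ ≡ stage t ++ y
stage-extends {t} ≤′-refl = [] , sym (++-identityʳ (stage t))
stage-extends {t} (≤′-step {t′} t≤′t′) with y , stage≡ ← stage-extends t≤′t′ =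
  y ++ block , trans (cong (_++ block) stage≡) (++-assoc (stage t) y block)
  where block = repeat (suc (length (stage t′))) (word (schedule t′) ++ word (schedule t′))

t≤length-stage : ∀ t → t ≤ length (stage t)
t≤length-stage zero    = z≤n
t≤length-stage (suc t) = begin
  suc t                                     ≡⟨ +-comm 1 t ⟩
  t + 1                                     ≤⟨ +-mono-≤ (t≤length-stage t) 1≤block ⟩
  length (stage t) + length block           ≡⟨ length-++ (stage t) ⟨
  length (stage (suc t))                    ∎
  where
    open ≤-Reasoning
    w = word (schedule t)
    block = repeat (suc (length (stage t))) (w ++ w)
    1≤block : 1 ≤ length block
    1≤block = ≤-trans (subst (1 ≤_) (sym (word-length (schedule t))) (s≤s z≤n))
                (≤-trans (length-++-≤ˡ w) (length-++-≤ˡ (w ++ w)))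

lookupOr : Bool → Str → ℕ → Bool
lookupOr d []      i       = d
lookupOr d (b ∷ x) zero    = b
lookupOr d (b ∷ x) (suc i) = lookupOr d x i

lookupOr-++ : ∀ d x y i → i < length x → lookupOr d (x ++ y) i ≡ lookupOr d x i
lookupOr-++ d (b ∷ x) y zero    _         = refl
lookupOr-++ d (b ∷ x) y (suc i) (s≤s i<x) = lookupOr-++ d x y i i<x

applyUpTo-lookupOr : ∀ (f : ℕ → Bool) d x → (∀ i → i < length x → f i ≡ lookupOr d x i) → applyUpTo f (length x) ≡ x
applyUpTo-lookupOr f d []      f≡ = refl
applyUpTo-lookupOr f d (b ∷ x) f≡ =
  cong₂ _∷_ (f≡ 0 (s≤s z≤n)) (applyUpTo-lookupOr (f ∘ suc) d x (λ i i<x → f≡ (suc i) (s≤s i<x)))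

-- Bit i is read off stage i + 1, which already has length > i.
S : ℕ → Bool
S i = lookupOr false (stage (suc i)) i

S-stage : ∀ t i → i < length (stage t) → S i ≡ lookupOr false (stage t) i
S-stage t i i<t with ≤-total (suc i) t
... | inj₁ i<t′ with y , stage≡ ← stage-extends (≤⇒≤′ i<t′) =
  sym (trans (cong (λ x → lookupOr false x i) stage≡) (lookupOr-++ false (stage (suc i)) y i (t≤length-stage (suc i))))
... | inj₂ t≤i with y , stage≡ ← stage-extends (≤⇒≤′ t≤i) =
  trans (cong (λ x → lookupOr false x i) stage≡) (lookupOr-++ false (stage t) y i i<t)

prefix-stage : ∀ t → prefix S (length (stage t)) ≡ stage t
prefix-stage t = applyUpTo-lookupOr S false (stage t) (S-stage t)

theorem3 : ∃[ S ] FSDeep S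
theorem3 = S , 1 , 8 , s≤s z≤n , s≤s z≤n , λ k → size (repeater (word k ++ word k)) , deep k
  where
    deep : ∀ k m → ∃[ n ] (m ≤ n × DepthGap k (size (repeater (word k ++ word k))) 1 8 (prefix S n) n)
    deep k m with t , m≤t , refl ← schedule-hits k m =
      length (stage (suc t)) ,
      ≤-trans m≤t (≤-trans (n≤1+n t) (t≤length-stage (suc t))) ,
      let w = word (schedule t) in
      subst (λ x → DepthGap (schedule t) (size (repeater (w ++ w))) 1 8 x (length (stage (suc t))))
            (sym (prefix-stage (suc t))) (stage-gap t)
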